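{- Let $A=(1,a_1,\ldots,a_k)$ be an orderly currency with $k\geq 1$. Then $a_i-a_{i-1}\geq a_1-1$ for all $i=1,\ldots,k$.
   Context: A currency is a finite sequence of integers $A=(a_0,a_1,\ldots,a_k)$ with $1=a_0<a_1<\cdots<a_k$. For an integer amount $c>0$, $\mathrm{opt}_A(c)$ is the minimum number of coins (values from $A$, repetitions allowed) summing to $c$, and $\mathrm{grd}_A(c)$ is the number of coins used by the greedy algorithm, which repeatedly takes the largest coin not exceeding the remaining amount. $A$ is orderly if $\mathrm{opt}_A(c)=\mathrm{grd}_A(c)$ for all integers $c>0$. -}

module Defs where

open import Data.Nat using (ℕ; zero; suc; _+_; _*_; _∸_; _≤_; _<_; _≤ᵇ_; _⊔_)
open import Data.Nat.ListAction using (sum)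
open import Data.Fin using (Fin) renaming (_<_ to _<ᶠ_; zero to fzero)
open import Data.List using (List; map; foldr; allFin)
open import Relation.Binary.PropositionalEquality using (_≡_)
open import Data.Bool using (if_then_else_)
open import Data.Product using (Σ; _×_)

-- A currency with k+1 coins is given as a : Fin (suc k) → ℕ  (a i = a_i).
-- It is a currency when a 0 = 1 and a is strictly increasing.
IsCurrency : (k : ℕ) → (Fin (suc k) → ℕ) → Set
IsCurrency k a = (a fzero ≡ 1) × (∀ (i j : Fin (suc k)) → i <ᶠ j → a i < a j)

Σᶠ : {k : ℕ} → (Fin (suc k) → ℕ) → ℕ
Σᶠ {k} f = sum (map f (allFin (suc k)))

-- a multiset of coins: m i = number of copies of coin a i
-- value of a multiset of coins, and its number of coins
value : {k : ℕ} → (Fin (suc k) → ℕ) → (Fin (suc k) → ℕ) → ℕ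
value a m = Σᶠ (λ i → m i * a i)

count : {k : ℕ} → (Fin (suc k) → ℕ) → ℕ
count m = Σᶠ m

IsOpt : {k : ℕ} → (Fin (suc k) → ℕ) → ℕ → ℕ → Set
IsOpt {k} a c n =
  Σ (Fin (suc k) → ℕ) (λ m → (value a m ≡ c) × (count m ≡ n))
  × (∀ (m : Fin (suc k) → ℕ) → value a m ≡ c → n ≤ count m)

-- largest coin not exceeding r (0 if none)
largestCoinLE : {k : ℕ} → (Fin (suc k) → ℕ) → ℕ → ℕ
largestCoinLE {k} a r =
  foldr (λ x acc → if x ≤ᵇ r then x ⊔ acc else acc) 0 (map a (allFin (suc k)))

-- greedy algorithm with fuel: repeatedly take the largest coin not exceeding
-- the remaining amount, counting coins.  Fuel c suffices since a 0 = 1.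
grdAux : {k : ℕ} → (Fin (suc k) → ℕ) → ℕ → ℕ → ℕ
grdAux a zero r = 0
grdAux a (suc f) zero = 0
grdAux a (suc f) (suc r) = suc (grdAux a f (suc r ∸ largestCoinLE a (suc r)))

grd : {k : ℕ} → (Fin (suc k) → ℕ) → ℕ → ℕ
grd a c = grdAux a c c

Orderly : {k : ℕ} → (Fin (suc k) → ℕ) → Set
Orderly a = ∀ (c : ℕ) → 0 < c → IsOpt a c (grd a c)

module Submission where

-- Orderliness is only used through one consequence (greedyRemainder): the
-- sum u + v of two coins has an optimal representation with 2 coins, so the
-- greedy algorithm uses at most 2 coins on it, i.e. u + v − G(u + v) is 0 or
-- a coin, where G(r) is the largest coin ≤ r.
--
-- Fix any b such that every coin is 1 or ≥ b (later b = a₁).  Call coins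
-- x < x + e "close" when 1 ≤ e ≤ b − 2.  We show that no close pair exists
-- by lexicographic induction on (e, x): for a minimal close pair with
-- x = t + 1, the coin x is "rising" (x < G(x + t)), and a case analysis on
-- the greedy coins of w + x and w + x + e (using greedyRemainder and
-- minimality) shows that G(w + t) is again a rising coin whenever w is.
-- This yields an infinite increasing sequence of coins, which is absurd.

open import Defs
import Data.Fin
open import Data.Fin using (Fin; fromℕ<; inject₁) renaming (zero to fzero; suc to fsuc)
open import Data.Fin.Properties using (≤̄⇒inject₁<)
open import Data.Nat using (ℕ; zero; suc; _+_; _*_; _∸_; _≤_; _<_; _≥_; s≤s; z≤n; _≤ᵇ_; _⊔_; _≤?_; _<?_)
open import Data.Nat.Properties
open import Data.Nat.Induction using (<-rec)
open import Data.Nat.ListAction using (sum)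
open import Data.List using (List; []; _∷_; map; foldr; allFin; tabulate)
open import Data.List.Properties using (map-tabulate)
open import Data.List.Membership.Propositional using (_∈_)
open import Data.List.Membership.Propositional.Properties using (∈-map⁺; ∈-map⁻; ∈-allFin)
open import Data.List.Relation.Unary.Any using (here; there)
open import Data.Bool using (true; false; if_then_else_; T)
open import Data.Product using (Σ; _,_; proj₁; proj₂)
open import Data.Sum using (_⊎_; inj₁; inj₂)
open import Data.Empty using (⊥; ⊥-elim)
open import Data.Unit using (tt)
open import Relation.Nullary using (¬_; yes; no)
open import Relation.Binary.PropositionalEquality
open import Algebra.Properties.CommutativeMonoid.Sum +-0-commutativeMonoid
  using (∑-distrib-+; sum-cong-≗; sum-replicate-zero) renaming (sum to ∑)

-- maxBelow r xs is the largest element of xs that is ≤ r, or 0 if there is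
-- none; largestCoinLE a r is (definitionally) maxBelow r of the coin values.
maxBelow : ℕ → List ℕ → ℕ
maxBelow r = foldr (λ x acc → if x ≤ᵇ r then x ⊔ acc else acc) 0

maxBelow-≤ : ∀ r xs → maxBelow r xs ≤ r
maxBelow-≤ r [] = z≤n
maxBelow-≤ r (x ∷ xs) with x ≤ᵇ r in x≤ᵇr
... | true = ⊔-lub (≤ᵇ⇒≤ x r (subst T (sym x≤ᵇr) tt)) (maxBelow-≤ r xs)
... | false = maxBelow-≤ r xs

maxBelow-∈ : ∀ r xs → maxBelow r xs ≡ 0 ⊎ maxBelow r xs ∈ xs
maxBelow-∈ r [] = inj₁ refl
maxBelow-∈ r (x ∷ xs) with x ≤ᵇ r | maxBelow-∈ r xs
... | false | inj₁ none = inj₁ none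
... | false | inj₂ found = inj₂ (there found)
... | true | rest with ⊔-sel x (maxBelow r xs)
...   | inj₁ is-x = inj₂ (here is-x)
...   | inj₂ is-rest with rest
...     | inj₁ none = inj₁ (trans is-rest none)
...     | inj₂ found = inj₂ (there (subst (_∈ xs) (sym is-rest) found))

maxBelow-greatest : ∀ r xs {c} → c ∈ xs → c ≤ r → c ≤ maxBelow r xs
maxBelow-greatest r (x ∷ xs) (here refl) c≤r with x ≤ᵇ r in x≤ᵇr
... | true = m≤m⊔n x (maxBelow r xs)
... | false = ⊥-elim (subst T x≤ᵇr (≤⇒≤ᵇ c≤r))
maxBelow-greatest r (x ∷ xs) (there c∈xs) c≤r with x ≤ᵇ r
... | true = ≤-trans (maxBelow-greatest r xs c∈xs c≤r) (m≤n⊔m x (maxBelow r xs))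
... | false = maxBelow-greatest r xs c∈xs c≤r

-- Σᶠ (a sum over a list) agrees with the library's vector sum ∑, whose
-- linearity lemmas are used to evaluate values and counts of multisets.
sum-tabulate : ∀ {n} (f : Fin n → ℕ) → sum (tabulate f) ≡ ∑ f
sum-tabulate {zero} f = refl
sum-tabulate {suc n} f = cong (f fzero +_) (sum-tabulate (λ t → f (fsuc t)))

Σᶠ≡∑ : ∀ {k} (f : Fin (suc k) → ℕ) → Σᶠ f ≡ ∑ f
Σᶠ≡∑ f = trans (cong sum (map-tabulate (λ i → i) f)) (sum-tabulate f)

term≤∑ : ∀ {n} (g : Fin n → ℕ) (i : Fin n) → g i ≤ ∑ g
term≤∑ g fzero = m≤m+n (g fzero) _
term≤∑ g (fsuc i) = ≤-trans (term≤∑ (λ t → g (fsuc t)) i) (m≤n+m _ (g fzero))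

δ : ∀ {n} → Fin n → Fin n → ℕ
δ fzero fzero = 1
δ fzero (fsuc _) = 0
δ (fsuc _) fzero = 0
δ (fsuc i) (fsuc j) = δ i j

∑-δ* : ∀ {n} (i : Fin n) (g : Fin n → ℕ) → ∑ (λ t → δ i t * g t) ≡ g i
∑-δ* {suc n} fzero g =
  trans (cong₂ _+_ (*-identityˡ (g fzero)) (sum-replicate-zero n)) (+-identityʳ (g fzero))
∑-δ* (fsuc i) g = ∑-δ* i (λ t → g (fsuc t))

∑-δ : ∀ {n} (i : Fin n) → ∑ (δ i) ≡ 1
∑-δ i = trans (sum-cong-≗ (λ t → sym (*-identityʳ (δ i t)))) (∑-δ* i (λ _ → 1))

pair : ∀ {k} → Fin (suc k) → Fin (suc k) → Fin (suc k) → ℕ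
pair i j t = δ i t + δ j t

value-pair : ∀ {k} (a : Fin (suc k) → ℕ) (i j : Fin (suc k)) → value a (pair i j) ≡ a i + a j
value-pair a i j = begin
    Σᶠ (λ t → (δ i t + δ j t) * a t)
  ≡⟨ Σᶠ≡∑ (λ t → (δ i t + δ j t) * a t) ⟩
    ∑ (λ t → (δ i t + δ j t) * a t)
  ≡⟨ sum-cong-≗ (λ t → *-distribʳ-+ (a t) (δ i t) (δ j t)) ⟩
    ∑ (λ t → δ i t * a t + δ j t * a t)
  ≡⟨ ∑-distrib-+ (λ t → δ i t * a t) (λ t → δ j t * a t) ⟩
    ∑ (λ t → δ i t * a t) + ∑ (λ t → δ j t * a t)
  ≡⟨ cong₂ _+_ (∑-δ* i a) (∑-δ* j a) ⟩
    a i + a j ∎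
  where open ≡-Reasoning

count-pair : ∀ {k} (i j : Fin (suc k)) → count (pair i j) ≡ 2
count-pair i j =
  trans (Σᶠ≡∑ (pair i j)) (trans (∑-distrib-+ (δ i) (δ j)) (cong₂ _+_ (∑-δ i) (∑-δ j)))

coins : ∀ {k} → (Fin (suc k) → ℕ) → List ℕ
coins {k} a = map a (allFin (suc k))

Coin : ∀ {k} → (Fin (suc k) → ℕ) → ℕ → Set
Coin a c = c ∈ coins a

module Currency {k : ℕ} (a : Fin (suc k) → ℕ) (cur : IsCurrency k a) where

  a₀≡1 : a fzero ≡ 1
  a₀≡1 = proj₁ cur

  increasing : ∀ i j → i Data.Fin.< j → a i < a j
  increasing = proj₂ cur

  G : ℕ → ℕ
  G = largestCoinLE a

  M : ℕ
  M = ∑ a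

  index-coin : ∀ i → Coin a (a i)
  index-coin i = ∈-map⁺ a (∈-allFin i)

  coin-index : ∀ {c} → Coin a c → Σ (Fin (suc k)) (λ i → a i ≡ c)
  coin-index c∈ with ∈-map⁻ a c∈
  ... | i , _ , c≡ai = i , sym c≡ai

  coin-1 : Coin a 1
  coin-1 = subst (Coin a) a₀≡1 (index-coin fzero)

  coin-pos : ∀ {c} → Coin a c → 1 ≤ c
  coin-pos c∈ with coin-index c∈
  ... | fzero , refl = ≤-reflexive (sym a₀≡1)
  ... | fsuc j , refl =
    ≤-trans (≤-reflexive (sym a₀≡1)) (<⇒≤ (increasing fzero (fsuc j) (s≤s z≤n)))

  coin+n≥1 : ∀ {c} n → Coin a c → 1 ≤ c + n
  coin+n≥1 {c} n c∈ = ≤-trans (coin-pos c∈) (m≤m+n c n)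

  coin≤M : ∀ {c} → Coin a c → c ≤ M
  coin≤M c∈ with coin-index c∈
  ... | i , refl = term≤∑ a i

  G-≤ : ∀ r → G r ≤ r
  G-≤ r = maxBelow-≤ r (coins a)

  G-greatest : ∀ r {c} → Coin a c → c ≤ r → c ≤ G r
  G-greatest r = maxBelow-greatest r (coins a)

  G-pos : ∀ {r} → 1 ≤ r → 1 ≤ G r
  G-pos {r} 1≤r = G-greatest r coin-1 1≤r

  G-coin : ∀ {r} → 1 ≤ r → Coin a (G r)
  G-coin {r} 1≤r with maxBelow-∈ r (coins a)
  ... | inj₂ found = found
  ... | inj₁ none = ⊥-elim (<-irrefl (sym none) (G-pos 1≤r))

  G-mono : ∀ {r s} → 1 ≤ r → r ≤ s → G r ≤ G s
  G-mono {r} {s} 1≤r r≤s = G-greatest s (G-coin 1≤r) (≤-trans (G-≤ r) r≤s)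

  remainder-< : ∀ r → suc r ∸ G (suc r) ≤ r
  remainder-< r = ∸-monoʳ-≤ (suc r) (G-pos (s≤s z≤n))

  grdAux-fuel : ∀ f g r → r ≤ f → r ≤ g → grdAux a f r ≡ grdAux a g r
  grdAux-fuel zero zero zero _ _ = refl
  grdAux-fuel zero (suc g) zero _ _ = refl
  grdAux-fuel (suc f) zero zero _ _ = refl
  grdAux-fuel (suc f) (suc g) zero _ _ = refl
  grdAux-fuel (suc f) (suc g) (suc r) (s≤s r≤f) (s≤s r≤g) =
    cong suc (grdAux-fuel f g _ (≤-trans (remainder-< r) r≤f) (≤-trans (remainder-< r) r≤g))

  grd-step : ∀ c → grd a (suc c) ≡ suc (grd a (suc c ∸ G (suc c)))
  grd-step c = cong suc (grdAux-fuel c _ _ (remainder-< c) ≤-refl)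

  grd≤0⇒0 : ∀ n → grd a n ≤ 0 → n ≡ 0
  grd≤0⇒0 zero _ = refl

  grd≤1⇒coin : ∀ {r} → 1 ≤ r → grd a r ≤ 1 → Coin a r
  grd≤1⇒coin {suc r} _ grd≤1 = subst (Coin a) G≡r (G-coin (s≤s z≤n))
    where
    rest≤0 : grd a (suc r ∸ G (suc r)) ≤ 0
    rest≤0 = ≤-pred (subst (_≤ 1) (grd-step r) grd≤1)
    G≡r : G (suc r) ≡ suc r
    G≡r = ≤-antisym (G-≤ (suc r)) (m∸n≡0⇒m≤n (grd≤0⇒0 _ rest≤0))

  remainder-coin : ∀ {c} → 1 ≤ c → grd a c ≤ 2 → c ∸ G c ≡ 0 ⊎ Coin a (c ∸ G c)
  remainder-coin {suc n} _ grd≤2 with 1 ≤? suc n ∸ G (suc n)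
  ... | no remainder≱1 = inj₁ (n≤0⇒n≡0 (≤-pred (≰⇒> remainder≱1)))
  ... | yes remainder≥1 =
    inj₂ (grd≤1⇒coin remainder≥1 (≤-pred (subst (_≤ 2) (grd-step n) grd≤2)))

  module Orderly-currency (ord : Orderly a) where

    -- u + v is paid optimally with the two coins u, v, and greedy is optimal
    grd-two-coins : ∀ {u v} → Coin a u → Coin a v → grd a (u + v) ≤ 2
    grd-two-coins u∈ v∈ with coin-index u∈ | coin-index v∈
    ... | i , refl | j , refl =
      subst (grd a (a i + a j) ≤_) (count-pair i j)
        (proj₂ (ord (a i + a j) (coin+n≥1 (a j) u∈))
          (pair i j) (value-pair a i j))

    greedyRemainder : ∀ {u v} → Coin a u → Coin a v →
                      u + v ∸ G (u + v) ≡ 0 ⊎ Coin a (u + v ∸ G (u + v))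
    greedyRemainder {u} {v} u∈ v∈ =
      remainder-coin (coin+n≥1 v u∈) (grd-two-coins u∈ v∈)

    module Spread (b : ℕ) (coin-1-or-≥b : ∀ {c} → Coin a c → c ≡ 1 ⊎ b ≤ c) where

      record Close (e x : ℕ) : Set where
        field
          e≥1 : 1 ≤ e
          e+2≤b : suc (suc e) ≤ b
          coin-x : Coin a x
          coin-x+e : Coin a (x + e)

      module MinimalClose (e t : ℕ) (close : Close e (suc t))
               (smaller-e : ∀ {e'} → e' < e → ∀ x' → ¬ Close e' x')
               (smaller-x : ∀ {x'} → x' < suc t → ¬ Close e x') where
        open Close close

        x : ℕ
        x = suc t

        -- x ≠ 1, as otherwise the coin 1 + e would lie strictly between 1 and b
        b≤x : b ≤ x
        b≤x with coin-1-or-≥b coin-x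
        ... | inj₂ b≤x = b≤x
        ... | inj₁ refl with coin-1-or-≥b coin-x+e
        ...   | inj₁ 1+e≡1 = ⊥-elim (<-irrefl (sym 1+e≡1) (s≤s e≥1))
        ...   | inj₂ b≤1+e = ⊥-elim (<-irrefl refl (≤-trans e+2≤b b≤1+e))

        -- from e + 2 ≤ b ≤ t + 1
        e<t : e < t
        e<t = ≤-pred (≤-trans e+2≤b b≤x)

        e<x : e < x
        e<x = ≤-trans e<t (n≤1+n t)

        NoCoinAbove : ℕ → Set
        NoCoinAbove c = ∀ {q} → Coin a q → c < q → q ≤ c + t → ⊥

        Rising : ℕ → Set
        Rising w = w < G (w + t)

        module Climb (w : ℕ) (coin-w : Coin a w) (rising : Rising w)
                     (gap : NoCoinAbove (G (w + t))) where
          c : ℕ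
          c = G (w + t)

          Q : ℕ
          Q = G (w + (x + e))

          w+t≥1 : 1 ≤ w + t
          w+t≥1 = coin+n≥1 t coin-w

          w+x+e≥1 : 1 ≤ w + (x + e)
          w+x+e≥1 = coin+n≥1 (x + e) coin-w

          w+x≤c+t : w + x ≤ c + t
          w+x≤c+t = subst (_≤ c + t) (sym (+-suc w t)) (+-monoˡ-≤ t rising)

          c<w+x : c < w + x
          c<w+x = ≤-<-trans (G-≤ (w + t)) (+-monoʳ-< w ≤-refl)

          -- since there is no coin in (c, w + x], greedy takes c on w + x too
          G[w+x]≡c : G (w + x) ≡ c
          G[w+x]≡c with c <? G (w + x)
          ... | yes c<P = ⊥-elim (gap (G-coin (coin+n≥1 x coin-w)) c<P
                                      (≤-trans (G-≤ (w + x)) w+x≤c+t))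
          ... | no c≮P = ≤-antisym (≮⇒≥ c≮P) (G-mono w+t≥1 (+-monoʳ-≤ w (n≤1+n t)))

          r : ℕ
          r = w + x ∸ G (w + x)

          r<x : r < x
          r<x = subst (r <_) (m+n∸m≡n w x)
                  (∸-monoʳ-< (subst (w <_) (sym G[w+x]≡c) rising) (G-≤ (w + x)))

          r≢0 : r ≡ 0 → ⊥
          r≢0 r≡0 = <-irrefl refl
            (<-≤-trans c<w+x (subst (w + x ≤_) G[w+x]≡c (m∸n≡0⇒m≤n r≡0)))

          remainder≡r+e : Q ≡ c → w + (x + e) ∸ Q ≡ r + e
          remainder≡r+e Q≡c = trans (cong₂ _∸_ (sym (+-assoc w x e)) (trans Q≡c (sym G[w+x]≡c)))
                                    (+-∸-comm e (G-≤ (w + x)))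

          -- Case 1: greedy takes the same coin c on w + x + e, leaving r + e;
          -- then r and r + e form a close pair below x.
          same-coin : Q ≡ c → ⊥
          same-coin Q≡c with greedyRemainder coin-w coin-x | greedyRemainder coin-w coin-x+e
          ... | inj₁ r≡0 | _ = r≢0 r≡0
          ... | inj₂ _ | inj₁ r+e≡0 =
            <-irrefl (sym (trans (sym (remainder≡r+e Q≡c)) r+e≡0)) (≤-trans e≥1 (m≤n+m e r))
          ... | inj₂ coin-r | inj₂ coin-r+e = smaller-x r<x record
            { e≥1 = e≥1 ; e+2≤b = e+2≤b ; coin-x = coin-r
            ; coin-x+e = subst (Coin a) (remainder≡r+e Q≡c) coin-r+e }

          -- Case 2: greedy takes a coin beyond w + x on w + x + e.  It cannot lie
          -- in the empty window (c, c + t], which forces c ≤ w + e.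
          beyond-window : w + x < Q → c ≤ w + e
          beyond-window w+x<Q with Q ≤? c + t
          ... | yes Q≤c+t = ⊥-elim (gap (G-coin w+x+e≥1) (<-trans c<w+x w+x<Q) Q≤c+t)
          ... | no Q≰c+t = +-cancelʳ-≤ x c (w + e) (begin
              c + x              ≡⟨ +-suc c t ⟩
              suc (c + t)        ≤⟨ ≰⇒> Q≰c+t ⟩
              Q                  ≤⟨ G-≤ (w + (x + e)) ⟩
              w + (x + e)        ≡⟨ cong (w +_) (+-comm x e) ⟩
              w + (e + x)        ≡⟨ sym (+-assoc w e x) ⟩
              w + e + x          ∎)
            where open ≤-Reasoning

          -- Case 2a: if c < w + e then w and c are a close pair with a smaller gap.
          smaller-gap : c < w + e → ⊥
          smaller-gap c<w+e = smaller-e gap<e w record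
            { e≥1 = m<n⇒0<n∸m rising
            ; e+2≤b = ≤-trans (s≤s (s≤s (<⇒≤ gap<e))) e+2≤b
            ; coin-x = coin-w
            ; coin-x+e = subst (Coin a) (sym (m+[n∸m]≡n (<⇒≤ rising))) (G-coin w+t≥1) }
            where
            gap<e : c ∸ w < e
            gap<e = subst (c ∸ w <_) (m+n∸m≡n w e) (∸-monoˡ-< c<w+e (<⇒≤ rising))

          -- Case 2b: if c = w + e then r = x − e, and x − e, x are a close pair below x.
          gap-is-e : c ≡ w + e → ⊥
          gap-is-e c≡w+e with greedyRemainder coin-w coin-x
          ... | inj₁ r≡0 = r≢0 r≡0
          ... | inj₂ coin-r = smaller-x (∸-monoʳ-< {o = 0} e≥1 e≤x) record
            { e≥1 = e≥1 ; e+2≤b = e+2≤b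
            ; coin-x = subst (Coin a) r≡x∸e coin-r
            ; coin-x+e = subst (Coin a) (sym (m∸n+n≡m e≤x)) coin-x }
            where
            e≤x : e ≤ x
            e≤x = <⇒≤ e<x
            r≡x∸e : r ≡ x ∸ e
            r≡x∸e = trans (cong (w + x ∸_) (trans G[w+x]≡c c≡w+e)) ([m+n]∸[m+o]≡n∸o w x e)

          impossible : ⊥
          impossible with Q ≤? w + x
          ... | yes Q≤w+x = same-coin (≤-antisym Q≤c c≤Q)
            where
            Q≤c : Q ≤ c
            Q≤c = subst (Q ≤_) G[w+x]≡c
                    (G-greatest (w + x) (G-coin w+x+e≥1) Q≤w+x)
            c≤Q : c ≤ Q
            c≤Q = G-mono w+t≥1 (+-monoʳ-≤ w (≤-trans (n≤1+n t) (m≤m+n x e)))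
          ... | no Q≰w+x with c <? w + e
          ...   | yes c<w+e = smaller-gap c<w+e
          ...   | no c≮w+e = gap-is-e (≤-antisym (beyond-window (≰⇒> Q≰w+x)) (≮⇒≥ c≮w+e))

        -- Above a rising coin w, the greedy coin G (w + t) is again rising:
        -- otherwise its window would be empty, contradicting Climb.
        ascend : ∀ {w} → Coin a w → Rising w → Rising (G (w + t))
        ascend {w} coin-w rising with G (G (w + t) + t) ≤? G (w + t)
        ... | no rises = ≰⇒> rises
        ... | yes stuck = ⊥-elim (Climb.impossible w coin-w rising empty-window)
          where
          empty-window : NoCoinAbove (G (w + t))
          empty-window {q} coin-q c<q q≤c+t =
            <-irrefl refl (<-≤-trans c<q (≤-trans (G-greatest _ coin-q q≤c+t) stuck))

        -- Iterating ascend produces ever larger coins, but coins are at most M;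
        -- n bounds the number of remaining steps.
        no-rising : ∀ n {w} → Coin a w → M ≤ w + n → ¬ Rising w
        no-rising zero {w} coin-w M≤w+0 rising =
          <-irrefl refl (<-≤-trans rising (≤-trans (coin≤M (G-coin (coin+n≥1 t coin-w)))
                                                   (subst (M ≤_) (+-identityʳ w) M≤w+0)))
        no-rising (suc n) {w} coin-w M≤w+1+n rising =
          no-rising n (G-coin (coin+n≥1 t coin-w))
            (≤-trans M≤w+1+n (subst (_≤ G (w + t) + n) (sym (+-suc w n)) (+-monoˡ-≤ n rising)))
            (ascend coin-w rising)

        -- x itself is rising, since the coin x + e ≤ x + t exceeds x
        x-rising : Rising x
        x-rising = <-≤-trans (m<m+n x e≥1) (G-greatest (x + t) coin-x+e (+-monoʳ-≤ x (<⇒≤ e<t)))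

        impossible : ⊥
        impossible = no-rising M coin-x (m≤n+m M x) x-rising

      no-close : ∀ e x → ¬ Close e x
      no-close = <-rec _ λ e smaller-e → <-rec _ λ x smaller-x → minimal e x smaller-e smaller-x
        where
        minimal : ∀ e x → (∀ {e'} → e' < e → ∀ x' → ¬ Close e' x') →
                  (∀ {x'} → x' < x → ¬ Close e x') → ¬ Close e x
        minimal e zero _ _ close = <-irrefl refl (coin-pos (Close.coin-x close))
        minimal e (suc t) smaller-e smaller-x close =
          MinimalClose.impossible e t close smaller-e smaller-x

      spread : ∀ {x y} → Coin a x → Coin a y → x < y → b ≤ suc (y ∸ x)
      spread {x} {y} coin-x coin-y x<y with b ≤? suc (y ∸ x)
      ... | yes b≤1+d = b≤1+d
      ... | no b≰1+d = ⊥-elim (no-close (y ∸ x) x record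
        { e≥1 = m<n⇒0<n∸m x<y
        ; e+2≤b = ≰⇒> b≰1+d
        ; coin-x = coin-x
        ; coin-x+e = subst (Coin a) (sym (m+[n∸m]≡n (<⇒≤ x<y))) coin-y })

coin-1-or-≥a₁ : ∀ {k} (a : Fin (suc (suc k)) → ℕ) → IsCurrency (suc k) a →
                ∀ {c} → Coin a c → c ≡ 1 ⊎ a (fsuc fzero) ≤ c
coin-1-or-≥a₁ a cur c∈ with Currency.coin-index a cur c∈
... | fzero , refl = inj₁ (proj₁ cur)
... | fsuc fzero , refl = inj₂ ≤-refl
... | fsuc (fsuc j) , refl =
  inj₂ (<⇒≤ (proj₂ cur (fsuc fzero) (fsuc (fsuc j)) (s≤s (s≤s z≤n))))

proposition3p2 : (k : ℕ) → (1≤k : 1 ≤ k) → (a : Fin (suc k) → ℕ) →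
    IsCurrency k a → Orderly a →
    (i : Fin k) → a (Data.Fin.suc i) ∸ a (inject₁ i) ≥ a (fromℕ< (s≤s 1≤k)) ∸ 1
proposition3p2 (suc k) (s≤s z≤n) a cur ord i =
  ∸-monoˡ-≤ 1 (spread (index-coin (inject₁ i)) (index-coin (fsuc i))
                      (increasing (inject₁ i) (fsuc i) (≤̄⇒inject₁< ≤-refl)))
  where
  open Currency a cur
  open Orderly-currency ord
  open Spread (a (fsuc fzero)) (coin-1-or-≥a₁ a cur)
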